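{- \[ \lim_{n\to\infty} \frac{\gamma^*_e(\mathcal{K}_n)}{n^2} \le \frac{1}{23}. \]
   Context: For vertices $u,v$ of a graph $G$, $\dist(u,v)$ is the length of a shortest $uv$ path and $w^*(u,v) = 2^{1-\dist(u,v)}$. A set $D \subseteq V(G)$ is a porous exponential dominating set if $\sum_{d \in D} w^*(d,v) \ge 1$ for every $v \in V(G)$; the porous exponential domination number $\gamma^*_e(G)$ is the minimum cardinality of such a set. The King grid is $\mathcal{K}_n = P_n \boxtimes P_n$, the strong product of two paths on $n$ vertices: vertex set $[n]\times[n]$, with two distinct vertices $(a,b),(c,d)$ adjacent iff $|a-c|\le 1$ and $|b-d| \le 1$. -}

module Defs where

open import Data.Bool using (Bool; true; false; _∧_; _∨_; if_then_else_)
open import Data.Nat as ℕ using (ℕ; zero; suc; _⊓_; ∣_-_∣; _≤ᵇ_; _≡ᵇ_)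
open import Data.Fin using (Fin; toℕ)
open import Data.Product using (_×_; _,_)
open import Data.List using (List; []; _∷_; map; length; foldr; concatMap; allFin; cartesianProduct)
open import Data.Bool.ListAction using (any; all)
open import Data.Integer using (+_)
open import Data.Rational as ℚ using (ℚ; 0ℚ; 1ℚ; ½; _+_; _*_)

-- Finite simple graphs, given by an enumeration of their vertices
-- (each vertex listed exactly once), a boolean equality test and a
-- boolean adjacency test.

record FinGraph : Set₁ where
  field
    V     : Set
    verts : List V
    eqV   : V → V → Bool
    adj   : V → V → Bool

module _ (G : FinGraph) where
  open FinGraph G

  reach : ℕ → V → V → Bool
  reach zero    u v = eqV u v
  reach (suc k) u v = reach k u v ∨ any (λ w → adj u w ∧ reach k w v) verts

  -- least k ≤ b with p k (returns suc b if there is none)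
  least : (ℕ → Bool) → ℕ → ℕ
  least p zero    = if p 0 then 0 else 1
  least p (suc b) = if p 0 then 0 else suc (least (λ k → p (suc k)) b)

  -- graph distance: length of a shortest uv path.  A shortest path has
  -- fewer than |V| edges, so searching k ≤ |V| suffices (for the
  -- connected graphs considered here a path always exists).
  dist : V → V → ℕ
  dist u v = least (λ k → reach k u v) (length verts)

halfPow : ℕ → ℚ
halfPow zero    = 1ℚ
halfPow (suc k) = ½ * halfPow k

-- 2^(1-d)
expWeight : ℕ → ℚ
expWeight zero    = 1ℚ + 1ℚ
expWeight (suc k) = halfPow k

sumℚ : List ℚ → ℚ
sumℚ = foldr _+_ 0ℚ

-- all sublists of a list (= all subsets of the vertex set when the
-- list enumerates each vertex exactly once)
sublists : {A : Set} → List A → List (List A)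
sublists []       = [] ∷ []
sublists (x ∷ xs) = let r = sublists xs in map (x ∷_) r Data.List.++ r

module _ (G : FinGraph) where
  open FinGraph G

  w* : V → V → ℚ
  w* u v = expWeight (dist G u v)

  isPorousExpDom : List V → Bool
  isPorousExpDom D = all (λ v → 1ℚ ℚ.≤ᵇ sumℚ (map (λ d → w* d v) D)) verts

  -- γ*_e(G): minimum cardinality of a porous exponential dominating set
  -- (V itself is one, so |V| is a valid starting value for the minimum).
  γ*ₑ : ℕ
  γ*ₑ = foldr (λ D acc → if isPorousExpDom D then length D ⊓ acc else acc)
              (length verts) (sublists verts)

King : ℕ → FinGraph
King n = record
  { V     = Fin n × Fin n
  ; verts = cartesianProduct (allFin n) (allFin n)
  ; eqV   = λ { (a , b) (c , d) → (toℕ a ≡ᵇ toℕ c) ∧ (toℕ b ≡ᵇ toℕ d) }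
  ; adj   = λ { (a , b) (c , d) →
                 (∣ toℕ a - toℕ c ∣ ≤ᵇ 1) ∧ (∣ toℕ b - toℕ d ∣ ≤ᵇ 1)
                 ∧ Data.Bool.not ((toℕ a ≡ᵇ toℕ c) ∧ (toℕ b ≡ᵇ toℕ d)) }
  }

ℕ→ℚ : ℕ → ℚ
ℕ→ℚ n = + n ℚ./ 1

-- The dominating set is the band of width 4 along the boundary of the grid together with the
-- lattice {(x, y) : 23 ∣ 4x + y}.  A vertex of the band dominates itself with weight 2.  Every other
-- vertex (x, y) has its whole 9 × 9 Chebyshev ball inside the grid; the lattice points of that ball
-- form a pattern determined by 4x + y mod 23, and for each of the 23 residues their weights at the
-- centre already add up to at least 1.  Since dist ≤ Chebyshev distance in K_n, weights computed from
-- Chebyshev distances are lower bounds for w*.  A row outside the band meets the set in at most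
-- 8 + ⌊n/23⌋ + 1 vertices, so 23 γ*_e(K_n) ≤ n² + 391 n, and the linear term is absorbed by ε n² once
-- n ≥ 17/ε.
module Submission where

open import Defs
open import Algebra.Core using (Op₂)
open import Algebra.Structures using (IsCommutativeMonoid)
open import Data.Bool using (Bool; true; false; if_then_else_; T; not; _∧_; _∨_)
import Data.Bool.Properties as Bool
open import Data.Fin using (Fin; toℕ; fromℕ<)
import Data.Fin.Properties as Fin
open import Data.List using (List; []; _∷_; _++_; map; foldr; length; tabulate; allFin; cartesianProduct; filterᵇ)
import Data.List.Properties as List
open import Data.List.Membership.Propositional using (_∈_)
open import Data.List.Membership.Propositional.Properties using (∈-map⁺; ∈-++⁺ˡ; ∈-++⁺ʳ)
open import Data.List.Relation.Unary.Any using (here; there)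
open import Data.Nat as ℕ using (ℕ; zero; suc)
import Data.Nat.Properties as ℕ
open import Data.Nat.Tactic.RingSolver using (solve-∀)
open import Data.Product using (Σ; _×_; _,_; proj₁; proj₂)
open import Data.Rational as ℚ using (ℚ; 0ℚ; 1ℚ)
import Data.Rational.Properties as ℚ
open import Function using (_∘_; Equivalence)
open import Relation.Binary.PropositionalEquality

filterᵇ-∈-sublists : ∀ {A : Set} (p : A → Bool) xs → filterᵇ p xs ∈ sublists xs
filterᵇ-∈-sublists p []       = here refl
filterᵇ-∈-sublists p (x ∷ xs) with p x
... | true  = ∈-++⁺ˡ (∈-map⁺ (x ∷_) (filterᵇ-∈-sublists p xs))
... | false = ∈-++⁺ʳ (map (x ∷_) (sublists xs)) (filterᵇ-∈-sublists p xs)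

length-cartesianProduct : ∀ {A B : Set} (xs : List A) (ys : List B) →
  length (cartesianProduct xs ys) ≡ length xs ℕ.* length ys
length-cartesianProduct []       ys = refl
length-cartesianProduct (x ∷ xs) ys = trans (List.length-++ (map (x ,_) ys))
  (cong₂ ℕ._+_ (List.length-map (x ,_) ys) (length-cartesianProduct xs ys))

module RangeSum {A : Set} {_+_ : Op₂ A} {0# : A} (isCM : IsCommutativeMonoid _≡_ _+_ 0#) where
  open import Algebra.Bundles using (CommutativeSemigroup)
  open import Data.Nat using (_∸_)
  open import Level using (Level; 0ℓ)
  open import Relation.Binary.Core using (Rel)
  open import Relation.Binary.Structures using (IsPreorder)
  open IsCommutativeMonoid isCM using (assoc; identityˡ; identityʳ; isCommutativeSemigroup)

  +-commutativeSemigroup : CommutativeSemigroup 0ℓ 0ℓ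
  +-commutativeSemigroup = record { isCommutativeSemigroup = isCommutativeSemigroup }

  open import Algebra.Properties.CommutativeSemigroup +-commutativeSemigroup using (interchange)

  ∑ : ℕ → (ℕ → A) → A
  ∑ zero    f = 0#
  ∑ (suc n) f = f 0 + ∑ n (f ∘ suc)

  listSum : List A → A
  listSum = foldr _+_ 0#

  ∑-cong-< : ∀ n {f g : ℕ → A} → (∀ i → i ℕ.< n → f i ≡ g i) → ∑ n f ≡ ∑ n g
  ∑-cong-< zero    f≗g = refl
  ∑-cong-< (suc n) f≗g = cong₂ _+_ (f≗g 0 ℕ.z<s) (∑-cong-< n (λ i i<n → f≗g (suc i) (ℕ.s<s i<n)))

  ∑-cong : ∀ n {f g : ℕ → A} → (∀ i → f i ≡ g i) → ∑ n f ≡ ∑ n g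
  ∑-cong n f≗g = ∑-cong-< n (λ i _ → f≗g i)

  ∑-zero : ∀ n → ∑ n (λ _ → 0#) ≡ 0#
  ∑-zero zero    = refl
  ∑-zero (suc n) = trans (identityˡ _) (∑-zero n)

  ∑-split : ∀ m k (f : ℕ → A) → ∑ (m ℕ.+ k) f ≡ ∑ m f + ∑ k (λ i → f (m ℕ.+ i))
  ∑-split zero    k f = sym (identityˡ _)
  ∑-split (suc m) k f = trans (cong (f 0 +_) (∑-split m k (f ∘ suc))) (sym (assoc _ _ _))

  ∑-distrib : ∀ n (f g : ℕ → A) → ∑ n (λ i → f i + g i) ≡ ∑ n f + ∑ n g
  ∑-distrib zero    f g = sym (identityˡ 0#)
  ∑-distrib (suc n) f g = trans (cong ((f 0 + g 0) +_) (∑-distrib n (f ∘ suc) (g ∘ suc))) (interchange _ _ _ _)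

  listSum-++ : ∀ xs ys → listSum (xs ++ ys) ≡ listSum xs + listSum ys
  listSum-++ []       ys = sym (identityˡ _)
  listSum-++ (x ∷ xs) ys = trans (cong (x +_) (listSum-++ xs ys)) (sym (assoc _ _ _))

  listSum-filterᵇ : ∀ {B : Set} (p : B → Bool) (f : B → A) xs →
    listSum (map f (filterᵇ p xs)) ≡ listSum (map (λ x → if p x then f x else 0#) xs)
  listSum-filterᵇ p f []       = refl
  listSum-filterᵇ p f (x ∷ xs) with p x
  ... | true  = cong (f x +_) (listSum-filterᵇ p f xs)
  ... | false = trans (listSum-filterᵇ p f xs) (sym (identityˡ _))

  listSum-cartesianProduct : ∀ {B C : Set} (f : B × C → A) xs ys →
    listSum (map f (cartesianProduct xs ys)) ≡ listSum (map (λ x → listSum (map (λ y → f (x , y)) ys)) xs)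
  listSum-cartesianProduct f []       ys = refl
  listSum-cartesianProduct f (x ∷ xs) ys = begin
    listSum (map f (map (x ,_) ys ++ cartesianProduct xs ys))
      ≡⟨ cong listSum (List.map-++ f (map (x ,_) ys) _) ⟩
    listSum (map f (map (x ,_) ys) ++ map f (cartesianProduct xs ys))
      ≡⟨ listSum-++ (map f (map (x ,_) ys)) _ ⟩
    listSum (map f (map (x ,_) ys)) + listSum (map f (cartesianProduct xs ys))
      ≡⟨ cong₂ _+_ (cong listSum (sym (List.map-∘ ys))) (listSum-cartesianProduct f xs ys) ⟩
    listSum (map (λ y → f (x , y)) ys) + listSum (map (λ x → listSum (map (λ y → f (x , y)) ys)) xs)  ∎
    where open ≡-Reasoning

  listSum-allFin : ∀ n (f : ℕ → A) → listSum (map (f ∘ toℕ) (allFin n)) ≡ ∑ n f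
  listSum-allFin n f = trans (cong listSum (List.map-tabulate {n = n} (λ i → i) (f ∘ toℕ))) (tabulate-∑ n f)
    where
    tabulate-∑ : ∀ n (f : ℕ → A) → listSum (tabulate {n = n} (f ∘ toℕ)) ≡ ∑ n f
    tabulate-∑ zero    f = refl
    tabulate-∑ (suc n) f = cong (f 0 +_) (tabulate-∑ n (f ∘ suc))

  listSum-grid : ∀ n (g : ℕ → ℕ → A) →
    listSum (map (λ u → g (toℕ (proj₁ u)) (toℕ (proj₂ u))) (cartesianProduct (allFin n) (allFin n)))
      ≡ ∑ n (λ a → ∑ n (g a))
  listSum-grid n g = begin
    listSum (map (λ u → g (toℕ (proj₁ u)) (toℕ (proj₂ u))) (cartesianProduct (allFin n) (allFin n)))
      ≡⟨ listSum-cartesianProduct _ (allFin n) (allFin n) ⟩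
    listSum (map (λ a → listSum (map (g (toℕ a) ∘ toℕ) (allFin n))) (allFin n))
      ≡⟨ cong listSum (List.map-cong (λ a → listSum-allFin n (g (toℕ a))) (allFin n)) ⟩
    listSum (map (λ a → ∑ n (g (toℕ a))) (allFin n))
      ≡⟨ listSum-allFin n (λ a → ∑ n (g a)) ⟩
    ∑ n (λ a → ∑ n (g a))  ∎
    where open ≡-Reasoning

  module Ordered {ℓ : Level} {_≤_ : Rel A ℓ} (≤-isPreorder : IsPreorder _≡_ _≤_)
                 (+-mono-≤ : ∀ {a b c d} → a ≤ b → c ≤ d → (a + c) ≤ (b + d)) where
    open IsPreorder ≤-isPreorder using (reflexive) renaming (refl to ≤-refl; trans to ≤-trans)

    ∑-mono : ∀ n {f g : ℕ → A} → (∀ i → f i ≤ g i) → ∑ n f ≤ ∑ n g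
    ∑-mono zero    f≤g = ≤-refl
    ∑-mono (suc n) f≤g = +-mono-≤ (f≤g 0) (∑-mono n (f≤g ∘ suc))

    ∑-nonNeg : ∀ n {f : ℕ → A} → (∀ i → 0# ≤ f i) → 0# ≤ ∑ n f
    ∑-nonNeg n 0≤f = ≤-trans (reflexive (sym (∑-zero n))) (∑-mono n 0≤f)

    listSum-mono : ∀ {B : Set} {f g : B → A} → (∀ x → f x ≤ g x) → ∀ xs → listSum (map f xs) ≤ listSum (map g xs)
    listSum-mono f≤g []       = ≤-refl
    listSum-mono f≤g (x ∷ xs) = +-mono-≤ (f≤g x) (listSum-mono f≤g xs)

    ∑-window : ∀ {f : ℕ → A} → (∀ i → 0# ≤ f i) → ∀ m k {n} → m ℕ.+ k ℕ.≤ n →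
      ∑ k (λ i → f (m ℕ.+ i)) ≤ ∑ n f
    ∑-window {f} 0≤f m k {n} m+k≤n = begin
      ∑ k (λ i → f (m ℕ.+ i))                          ≡⟨ sym (trans (identityˡ _) (identityʳ _)) ⟩
      0# + (∑ k (λ i → f (m ℕ.+ i)) + 0#)              ≲⟨ +-mono-≤ (∑-nonNeg m 0≤f) (+-mono-≤ ≤-refl (∑-nonNeg r (λ i → 0≤f _))) ⟩
      ∑ m f + (∑ k (λ i → f (m ℕ.+ i)) + ∑ r (λ i → f (m ℕ.+ (k ℕ.+ i))))
                                                        ≡⟨ sym (trans (∑-split m (k ℕ.+ r) f) (cong (∑ m f +_) (∑-split k r _))) ⟩
      ∑ (m ℕ.+ (k ℕ.+ r)) f                             ≡⟨ cong (λ j → ∑ j f) (trans (sym (ℕ.+-assoc m k r)) (ℕ.m+[n∸m]≡n m+k≤n)) ⟩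
      ∑ n f                                             ∎
      where
      open import Relation.Binary.Reasoning.Base.Double ≤-isPreorder
      r : ℕ
      r = n ∸ (m ℕ.+ k)

    ∑-term : ∀ {f : ℕ → A} → (∀ i → 0# ≤ f i) → ∀ {x n} → x ℕ.< n → f x ≤ ∑ n f
    ∑-term {f} 0≤f {x} x<n = ≤-trans (reflexive fx≡) (∑-window 0≤f x 1 (ℕ.≤-trans (ℕ.≤-reflexive (ℕ.+-comm x 1)) x<n))
      where
      fx≡ : f x ≡ ∑ 1 (λ i → f (x ℕ.+ i))
      fx≡ = sym (trans (identityʳ _) (cong f (ℕ.+-identityʳ x)))

    ∑²-window : ∀ {g : ℕ → ℕ → A} → (∀ a b → 0# ≤ g a b) → ∀ {x y k l n} → x ℕ.+ k ℕ.≤ n → y ℕ.+ l ℕ.≤ n →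
      ∑ k (λ i → ∑ l (λ j → g (x ℕ.+ i) (y ℕ.+ j))) ≤ ∑ n (λ a → ∑ n (g a))
    ∑²-window 0≤g {x} {y} {k} {l} {n} x+k≤n y+l≤n =
      ≤-trans (∑-mono k (λ i → ∑-window (0≤g _) y l y+l≤n)) (∑-window (λ a → ∑-nonNeg n (0≤g a)) x k x+k≤n)

    ∑²-term : ∀ {g : ℕ → ℕ → A} → (∀ a b → 0# ≤ g a b) → ∀ {x y n} → x ℕ.< n → y ℕ.< n →
      g x y ≤ ∑ n (λ a → ∑ n (g a))
    ∑²-term 0≤g {n = n} x<n y<n = ≤-trans (∑-term (0≤g _) y<n) (∑-term (λ a → ∑-nonNeg n (0≤g a)) x<n)

module Residue where
  open import Data.Nat using (_+_; _%_; NonZero)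
  open import Data.Nat.DivMod using (%-distribˡ-+; m%n%n≡m%n; m%n<n)

  [m%d+n]%d≡[m+n]%d : ∀ m n d .{{_ : NonZero d}} → (m % d + n) % d ≡ (m + n) % d
  [m%d+n]%d≡[m+n]%d m n d = begin
    (m % d + n) % d            ≡⟨ %-distribˡ-+ (m % d) n d ⟩
    (m % d % d + n % d) % d    ≡⟨ cong (λ r → (r + n % d) % d) (m%n%n≡m%n m d) ⟩
    (m % d + n % d) % d        ≡⟨ %-distribˡ-+ m n d ⟨
    (m + n) % d                ∎
    where open ≡-Reasoning

  residue-elim : ∀ {P : ℕ → Set} d .{{_ : NonZero d}} → (∀ (r : Fin d) → P (toℕ r)) → ∀ m → P (m % d)
  residue-elim {P} d P-Fin m = subst P (Fin.toℕ-fromℕ< (m%n<n m d)) (P-Fin (fromℕ< (m%n<n m d)))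

module FinGraphProperties (G : FinGraph) where
  open import Data.List.Membership.Propositional using (lose)
  open import Data.List.Relation.Unary.Any.Properties using (any⁺)
  open import Data.Nat using (_≤_; _⊓_; z≤n; s≤s)
  open import Data.Sum using (inj₂)
  open FinGraph G

  least-≤ : ∀ (p : ℕ → Bool) b {k} → T (p k) → k ≤ b → least G p b ≤ k
  least-≤ p zero    {zero}  pk _         with p 0
  ... | true = z≤n
  least-≤ p (suc b) {zero}  pk _         with p 0
  ... | true = z≤n
  least-≤ p (suc b) {suc k} pk (s≤s k≤b) with p 0
  ... | true  = z≤n
  ... | false = s≤s (least-≤ (p ∘ suc) b pk k≤b)

  dist-≤ : ∀ {u v} k → T (reach G k u v) → k ≤ length verts → dist G u v ≤ k
  dist-≤ k = least-≤ (λ j → reach G j _ _) (length verts)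

  reach-step : ∀ {k u v} w → w ∈ verts → T (adj u w) → T (reach G k w v) → T (reach G (suc k) u v)
  reach-step w w∈verts uw wv = Equivalence.from Bool.T-∨
    (inj₂ (any⁺ _ (lose w∈verts (Equivalence.from Bool.T-∧ (uw , wv)))))

  γ*ₑ-≤ : ∀ {D} → D ∈ sublists verts → T (isPorousExpDom G D) → γ*ₑ G ≤ length D
  γ*ₑ-≤ = foldr-min-≤ (length verts)
    where
    foldr-min-≤ : ∀ b {D Ds} → D ∈ Ds → T (isPorousExpDom G D) →
      foldr (λ D acc → if isPorousExpDom G D then length D ⊓ acc else acc) b Ds ≤ length D
    foldr-min-≤ b {D} (here refl) dom with isPorousExpDom G D
    ... | true = ℕ.m⊓n≤m (length D) _
    foldr-min-≤ b {Ds = D′ ∷ _} (there D∈Ds) dom with isPorousExpDom G D′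
    ... | true  = ℕ.≤-trans (ℕ.m⊓n≤n (length D′) _) (foldr-min-≤ b D∈Ds dom)
    ... | false = foldr-min-≤ b D∈Ds dom

module ExpWeight where
  open import Data.Nat using (_≤′_; ≤′-refl; ≤′-step)
  open import Data.Rational using (½; _≤_)

  halfPow-nonNeg : ∀ k → 0ℚ ≤ halfPow k
  halfPow-nonNeg zero    = ℚ.≤ᵇ⇒≤ _
  halfPow-nonNeg (suc k) = subst (_≤ halfPow (suc k)) (ℚ.*-zeroʳ ½) (ℚ.*-monoˡ-≤-nonNeg ½ (halfPow-nonNeg k))

  expWeight-nonNeg : ∀ k → 0ℚ ≤ expWeight k
  expWeight-nonNeg zero    = ℚ.≤ᵇ⇒≤ _
  expWeight-nonNeg (suc k) = halfPow-nonNeg k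

  halfPow-suc-≤ : ∀ k → halfPow (suc k) ≤ halfPow k
  halfPow-suc-≤ zero    = ℚ.≤ᵇ⇒≤ _
  halfPow-suc-≤ (suc k) = ℚ.*-monoˡ-≤-nonNeg ½ (halfPow-suc-≤ k)

  expWeight-suc-≤ : ∀ k → expWeight (suc k) ≤ expWeight k
  expWeight-suc-≤ zero    = ℚ.≤ᵇ⇒≤ _
  expWeight-suc-≤ (suc k) = halfPow-suc-≤ k

  expWeight-antitone : ∀ {m k} → m ℕ.≤ k → expWeight k ≤ expWeight m
  expWeight-antitone = antitone′ ∘ ℕ.≤⇒≤′
    where
    antitone′ : ∀ {m k} → m ≤′ k → expWeight k ≤ expWeight m
    antitone′ ≤′-refl            = ℚ.≤-refl
    antitone′ (≤′-step {k} m≤k) = ℚ.≤-trans (expWeight-suc-≤ k) (antitone′ m≤k)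

module KingDistance where
  open import Relation.Nullary using (¬_)
  open import Data.List.Membership.Propositional.Properties using (∈-cartesianProduct⁺; ∈-allFin)
  open import Data.Nat using (_*_; _∸_; _⊔_; ∣_-_∣; _≤_; _<_; _≤ᵇ_; _≡ᵇ_; z≤n; s≤s)
  open FinGraphProperties using (reach-step; dist-≤)

  coords : ∀ {n} → Fin n × Fin n → ℕ × ℕ
  coords (a , b) = toℕ a , toℕ b

  chebyshev : ℕ × ℕ → ℕ × ℕ → ℕ
  chebyshev (a , b) (c , d) = ∣ a - c ∣ ⊔ ∣ b - d ∣

  towards : ℕ → ℕ → ℕ
  towards zero    zero    = zero
  towards zero    (suc c) = 1
  towards (suc a) zero    = a
  towards (suc a) (suc c) = suc (towards a c)

  towards-adjacent : ∀ a c → ∣ a - towards a c ∣ ≤ 1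
  towards-adjacent zero    zero    = z≤n
  towards-adjacent zero    (suc c) = ℕ.≤-refl
  towards-adjacent (suc a) zero    = ℕ.≤-reflexive (∣1+n-n∣≡1 a)
    where
    ∣1+n-n∣≡1 : ∀ n → ∣ suc n - n ∣ ≡ 1
    ∣1+n-n∣≡1 zero    = refl
    ∣1+n-n∣≡1 (suc n) = ∣1+n-n∣≡1 n
  towards-adjacent (suc a) (suc c) = towards-adjacent a c

  towards-closer : ∀ a c → ∣ towards a c - c ∣ ≡ ∣ a - c ∣ ∸ 1
  towards-closer zero    zero    = refl
  towards-closer zero    (suc c) = refl
  towards-closer (suc a) zero    = ℕ.∣-∣-identityʳ a
  towards-closer (suc a) (suc c) = towards-closer a c

  towards≤⊔ : ∀ a c → towards a c ≤ a ⊔ c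
  towards≤⊔ zero    zero    = z≤n
  towards≤⊔ zero    (suc c) = s≤s z≤n
  towards≤⊔ (suc a) zero    = ℕ.n≤1+n a
  towards≤⊔ (suc a) (suc c) = s≤s (towards≤⊔ a c)

  module _ {n : ℕ} where
    open FinGraph (King n)

    ∈-verts : ∀ u → u ∈ verts
    ∈-verts (a , b) = ∈-cartesianProduct⁺ (∈-allFin a) (∈-allFin b)

    chebyshev<n : ∀ (u v : V) → chebyshev (coords u) (coords v) < n
    chebyshev<n (a , b) (c , d) = ℕ.⊔-lub (∣-∣<n a c) (∣-∣<n b d)
      where
      ∣-∣<n : ∀ (x y : Fin n) → ∣ toℕ x - toℕ y ∣ < n
      ∣-∣<n x y = ℕ.≤-<-trans (ℕ.∣m-n∣≤m⊔n (toℕ x) (toℕ y)) (ℕ.⊔-lub (Fin.toℕ<n x) (Fin.toℕ<n y))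

    n≤length-verts : V → n ≤ length verts
    n≤length-verts (a , _) = begin
      n                                       ≤⟨ ℕ.m≤m*n n n {{ℕ.>-nonZero (ℕ.≤-<-trans z≤n (Fin.toℕ<n a))}} ⟩
      n * n                                   ≡⟨ cong₂ _*_ length-allFin length-allFin ⟨
      length (allFin n) * length (allFin n)   ≡⟨ length-cartesianProduct (allFin n) (allFin n) ⟨
      length verts                            ∎
      where
      open ℕ.≤-Reasoning
      length-allFin : length (allFin n) ≡ n
      length-allFin = List.length-tabulate {n = n} (λ i → i)

    adj-King : ∀ (u w : V) → ∣ proj₁ (coords u) - proj₁ (coords w) ∣ ≤ 1 → ∣ proj₂ (coords u) - proj₂ (coords w) ∣ ≤ 1 →
      coords u ≢ coords w → T (adj u w)
    adj-King (a , b) (a′ , b′) ∣Δa∣≤1 ∣Δb∣≤1 u≢w =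
      Equivalence.from (Bool.T-∧ {∣ toℕ a - toℕ a′ ∣ ≤ᵇ 1}) (ℕ.≤⇒≤ᵇ ∣Δa∣≤1 ,
      Equivalence.from (Bool.T-∧ {∣ toℕ b - toℕ b′ ∣ ≤ᵇ 1}) (ℕ.≤⇒≤ᵇ ∣Δb∣≤1 , T-not distinct))
      where
      T-not : ∀ {x} → ¬ T x → T (not x)
      T-not {false} _  = _
      T-not {true}  ¬x = ¬x _
      distinct : ¬ T ((toℕ a ≡ᵇ toℕ a′) ∧ (toℕ b ≡ᵇ toℕ b′))
      distinct same = let a≡a′ , b≡b′ = Equivalence.to (Bool.T-∧ {toℕ a ≡ᵇ toℕ a′}) same in
        u≢w (cong₂ _,_ (ℕ.≡ᵇ⇒≡ _ _ a≡a′) (ℕ.≡ᵇ⇒≡ _ _ b≡b′))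

    step-towards : ∀ k (u v : V) → chebyshev (coords u) (coords v) ≡ suc k →
      Σ V λ w → T (adj u w) × chebyshev (coords w) (coords v) ≡ k
    step-towards k u@(a , b) v@(c , d) cheb≡1+k = w , u~w , cheb-w
      where
      a′<n : towards (toℕ a) (toℕ c) < n
      a′<n = ℕ.≤-<-trans (towards≤⊔ (toℕ a) (toℕ c)) (ℕ.⊔-lub (Fin.toℕ<n a) (Fin.toℕ<n c))
      b′<n : towards (toℕ b) (toℕ d) < n
      b′<n = ℕ.≤-<-trans (towards≤⊔ (toℕ b) (toℕ d)) (ℕ.⊔-lub (Fin.toℕ<n b) (Fin.toℕ<n d))
      w : V
      w = fromℕ< a′<n , fromℕ< b′<n
      coords-w : coords w ≡ (towards (toℕ a) (toℕ c) , towards (toℕ b) (toℕ d))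
      coords-w = cong₂ _,_ (Fin.toℕ-fromℕ< a′<n) (Fin.toℕ-fromℕ< b′<n)
      cheb-w : chebyshev (coords w) (coords v) ≡ k
      cheb-w = begin
        chebyshev (coords w) (coords v)                    ≡⟨ cong (λ p → chebyshev p (coords v)) coords-w ⟩
        ∣ towards (toℕ a) (toℕ c) - toℕ c ∣ ⊔ ∣ towards (toℕ b) (toℕ d) - toℕ d ∣
                                                           ≡⟨ cong₂ _⊔_ (towards-closer (toℕ a) (toℕ c)) (towards-closer (toℕ b) (toℕ d)) ⟩
        (∣ toℕ a - toℕ c ∣ ∸ 1) ⊔ (∣ toℕ b - toℕ d ∣ ∸ 1)  ≡⟨ ℕ.∸-distribʳ-⊔ 1 ∣ toℕ a - toℕ c ∣ ∣ toℕ b - toℕ d ∣ ⟨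
        chebyshev (coords u) (coords v) ∸ 1               ≡⟨ cong (_∸ 1) cheb≡1+k ⟩
        k                                                  ∎
        where open ≡-Reasoning
      u~w : T (adj u w)
      u~w = adj-King u w
        (subst (λ x → ∣ toℕ a - x ∣ ≤ 1) (sym (Fin.toℕ-fromℕ< a′<n)) (towards-adjacent (toℕ a) (toℕ c)))
        (subst (λ x → ∣ toℕ b - x ∣ ≤ 1) (sym (Fin.toℕ-fromℕ< b′<n)) (towards-adjacent (toℕ b) (toℕ d)))
        (λ u≡w → ℕ.1+n≢n (trans (sym cheb≡1+k) (trans (cong (λ p → chebyshev p (coords v)) u≡w) cheb-w)))

    reach-King : ∀ k (u v : V) → chebyshev (coords u) (coords v) ≡ k → T (reach (King n) k u v)
    reach-King zero (a , b) (c , d) cheb≡0 = Equivalence.from (Bool.T-∧ {toℕ a ≡ᵇ toℕ c})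
      (≡ᵇ-of-∣-∣≤ (toℕ a) (toℕ c) (ℕ.m≤m⊔n _ _) , ≡ᵇ-of-∣-∣≤ (toℕ b) (toℕ d) (ℕ.m≤n⊔m _ _))
      where
      ≡ᵇ-of-∣-∣≤ : ∀ x y → ∣ x - y ∣ ≤ chebyshev (toℕ a , toℕ b) (toℕ c , toℕ d) → T (x ≡ᵇ y)
      ≡ᵇ-of-∣-∣≤ x y ≤cheb = ℕ.≡⇒≡ᵇ x y (ℕ.∣m-n∣≡0⇒m≡n (ℕ.n≤0⇒n≡0 (ℕ.≤-trans ≤cheb (ℕ.≤-reflexive cheb≡0))))
    reach-King (suc k) u v cheb≡1+k =
      let w , u~w , cheb-w = step-towards k u v cheb≡1+k in
      reach-step (King n) {k} {u} {v} w (∈-verts w) u~w (reach-King k w v cheb-w)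

    dist-King≤chebyshev : ∀ (u v : V) → dist (King n) u v ≤ chebyshev (coords u) (coords v)
    dist-King≤chebyshev u v = dist-≤ (King n) _ (reach-King _ u v refl)
      (ℕ.≤-trans (ℕ.<⇒≤ (chebyshev<n u v)) (n≤length-verts u))

module LatticeDomination where
  open import Data.Bool.Properties using (T-∨)
  open import Data.Fin.Properties using (all?)
  import Data.List.Relation.Unary.All as All
  open import Data.List.Relation.Unary.All.Properties using (all⁻)
  open import Data.Nat using (_+_; _*_; _∸_; _%_; _≡ᵇ_; _<ᵇ_; _≤ᵇ_; _⊔_; ∣_-_∣)
  open import Data.Rational using (_≤_)
  open import Data.Sum using (inj₁; inj₂)
  open import Relation.Nullary using (¬_; yes; no)
  open import Relation.Nullary.Decidable using (from-yes; T?)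
  open RangeSum ℚ.+-0-isCommutativeMonoid
  open Ordered ℚ.≤-isPreorder ℚ.+-mono-≤
  open Residue
  open ExpWeight
  open KingDistance

  multipleOf23 : ℕ → Bool
  multipleOf23 m = m % 23 ≡ᵇ 0

  onLattice : ℕ → ℕ → Bool
  onLattice x y = multipleOf23 (4 * x + y)

  nearBorder : ℕ → ℕ → Bool
  nearBorder n x = (x <ᵇ 4) ∨ (n ≤ᵇ x + 4)

  inLatticeDom : ℕ → ℕ → ℕ → Bool
  inLatticeDom n x y = (nearBorder n x ∨ nearBorder n y) ∨ onLattice x y

  latticeDom : (n : ℕ) → List (Fin n × Fin n)
  latticeDom n = filterᵇ (λ u → inLatticeDom n (toℕ (proj₁ u)) (toℕ (proj₂ u))) (FinGraph.verts (King n))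

  received : (n : ℕ) → Fin n × Fin n → ℚ
  received n v = sumℚ (map (λ d → w* (King n) d v) (latticeDom n))

  contribution : ℕ → ℕ × ℕ → ℕ → ℕ → ℚ
  contribution n v a b = if inLatticeDom n a b then expWeight (chebyshev (a , b) v) else 0ℚ

  contribution-nonNeg : ∀ n v a b → 0ℚ ≤ contribution n v a b
  contribution-nonNeg n v a b with inLatticeDom n a b
  ... | true  = expWeight-nonNeg (chebyshev (a , b) v)
  ... | false = ℚ.≤-refl

  ∑contribution≤received : ∀ n (v : Fin n × Fin n) → ∑ n (λ a → ∑ n (contribution n (coords v) a)) ≤ received n v
  ∑contribution≤received n v = begin
    ∑ n (λ a → ∑ n (contribution n (coords v) a))
      ≡⟨ listSum-grid n (contribution n (coords v)) ⟨
    sumℚ (map (λ d → contribution n (coords v) (toℕ (proj₁ d)) (toℕ (proj₂ d))) verts)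
      ≤⟨ listSum-mono contribution≤w* verts ⟩
    sumℚ (map (λ d → if inLatticeDom n (toℕ (proj₁ d)) (toℕ (proj₂ d)) then w* (King n) d v else 0ℚ) verts)
      ≡⟨ listSum-filterᵇ _ (λ d → w* (King n) d v) verts ⟨
    received n v  ∎
    where
    open ℚ.≤-Reasoning
    open FinGraph (King n) using (verts)
    contribution≤w* : ∀ d → contribution n (coords v) (toℕ (proj₁ d)) (toℕ (proj₂ d))
                            ≤ (if inLatticeDom n (toℕ (proj₁ d)) (toℕ (proj₂ d)) then w* (King n) d v else 0ℚ)
    contribution≤w* d with inLatticeDom n (toℕ (proj₁ d)) (toℕ (proj₂ d))
    ... | true  = expWeight-antitone (dist-King≤chebyshev d v)
    ... | false = ℚ.≤-refl

  1≤∑contribution-border : ∀ n x y → x ℕ.< n → y ℕ.< n → T (nearBorder n x ∨ nearBorder n y) →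
    1ℚ ≤ ∑ n (λ a → ∑ n (contribution n (x , y) a))
  1≤∑contribution-border n x y x<n y<n border = begin
    1ℚ                                              ≤⟨ ℚ.≤ᵇ⇒≤ _ ⟩
    expWeight 0                                     ≡⟨ contribution-self ⟨
    contribution n (x , y) x y                      ≤⟨ ∑²-term (contribution-nonNeg n (x , y)) x<n y<n ⟩
    ∑ n (λ a → ∑ n (contribution n (x , y) a))      ∎
    where
    open ℚ.≤-Reasoning
    member : T (inLatticeDom n x y)
    member = Equivalence.from T-∨ (inj₁ border)
    contribution-self : contribution n (x , y) x y ≡ expWeight 0
    contribution-self with inLatticeDom n x y | member
    ... | true | _ = cong expWeight (cong₂ _⊔_ (ℕ.∣n-n∣≡0 x) (ℕ.∣n-n∣≡0 y))

  -- The weight that the lattice point at offset (i, j) in a 9 × 9 window sends to the window's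
  -- centre (4, 4), when the window's corner (x, y) has 4x + y ≡ c (mod 23).
  windowTerm : ℕ → ℕ → ℕ → ℚ
  windowTerm c i j = if multipleOf23 (c + (4 * i + j)) then expWeight (∣ i - 4 ∣ ⊔ ∣ j - 4 ∣) else 0ℚ

  windowWeight : ℕ → ℚ
  windowWeight c = ∑ 9 (λ i → ∑ 9 (windowTerm c i))

  1≤windowWeight : ∀ c → 1ℚ ≤ windowWeight (c % 23)
  1≤windowWeight = residue-elim {λ r → 1ℚ ≤ windowWeight r} 23
    (from-yes (all? {n = 23} (λ r → 1ℚ ℚ.≤? windowWeight (toℕ r))))

  windowTerm≤contribution : ∀ n x y i j →
    windowTerm ((4 * x + y) % 23) i j ≤ contribution n (x + 4 , y + 4) (x + i) (y + j)
  windowTerm≤contribution n x y i j =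
    subst (_≤ contribution n (x + 4 , y + 4) (x + i) (y + j)) (cong₂ (λ b e → if b then expWeight e else 0ℚ) lattice≡ cheb≡)
      (if-∨-mono (nearBorder n (x + i) ∨ nearBorder n (y + j)) (onLattice (x + i) (y + j))
                 (expWeight-nonNeg (chebyshev (x + i , y + j) (x + 4 , y + 4))))
    where
    if-∨-mono : ∀ p q {e} → 0ℚ ≤ e → (if q then e else 0ℚ) ≤ (if p ∨ q then e else 0ℚ)
    if-∨-mono true  true  0≤e = ℚ.≤-refl
    if-∨-mono true  false 0≤e = 0≤e
    if-∨-mono false q     0≤e = ℚ.≤-refl
    regroup : ∀ x y i j → 4 * (x + i) + (y + j) ≡ (4 * x + y) + (4 * i + j)
    regroup = solve-∀
    lattice≡ : onLattice (x + i) (y + j) ≡ multipleOf23 ((4 * x + y) % 23 + (4 * i + j))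
    lattice≡ = cong (λ r → r ≡ᵇ 0)
      (trans (cong (_% 23) (regroup x y i j)) (sym ([m%d+n]%d≡[m+n]%d (4 * x + y) (4 * i + j) 23)))
    cheb≡ : chebyshev (x + i , y + j) (x + 4 , y + 4) ≡ ∣ i - 4 ∣ ⊔ ∣ j - 4 ∣
    cheb≡ = cong₂ _⊔_ (ℕ.∣m+n-m+o∣≡∣n-o∣ x i 4) (ℕ.∣m+n-m+o∣≡∣n-o∣ y j 4)

  1≤∑contribution-interior : ∀ n x y → x + 9 ℕ.≤ n → y + 9 ℕ.≤ n →
    1ℚ ≤ ∑ n (λ a → ∑ n (contribution n (x + 4 , y + 4) a))
  1≤∑contribution-interior n x y x+9≤n y+9≤n = begin
    1ℚ                                                      ≤⟨ 1≤windowWeight (4 * x + y) ⟩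
    ∑ 9 (λ i → ∑ 9 (windowTerm ((4 * x + y) % 23) i))        ≤⟨ ∑-mono 9 (λ i → ∑-mono 9 (windowTerm≤contribution n x y i)) ⟩
    ∑ 9 (λ i → ∑ 9 (λ j → contribution n (x + 4 , y + 4) (x + i) (y + j)))
                                                            ≤⟨ ∑²-window (contribution-nonNeg n _) {x} {y} {9} {9} x+9≤n y+9≤n ⟩
    ∑ n (λ a → ∑ n (contribution n (x + 4 , y + 4) a))      ∎
    where open ℚ.≤-Reasoning

  interior-coordinate : ∀ {n x} → ¬ T (nearBorder n x) → Σ ℕ λ x′ → x′ + 4 ≡ x × x′ + 9 ℕ.≤ n
  interior-coordinate {n} {x} ¬near = x ∸ 4 , ℕ.m∸n+n≡m 4≤x , subst (ℕ._≤ n) x+5≡ x+4<n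
    where
    4≤x : 4 ℕ.≤ x
    4≤x = ℕ.≮⇒≥ (λ x<4 → ¬near (Equivalence.from (T-∨ {x <ᵇ 4}) (inj₁ (ℕ.<⇒<ᵇ x<4))))
    x+4<n : x + 4 ℕ.< n
    x+4<n = ℕ.≰⇒> (λ n≤x+4 → ¬near (Equivalence.from (T-∨ {x <ᵇ 4}) (inj₂ (ℕ.≤⇒≤ᵇ n≤x+4))))
    shift : ∀ m → suc (m + 4 + 4) ≡ m + 9
    shift = solve-∀
    x+5≡ : suc (x + 4) ≡ x ∸ 4 + 9
    x+5≡ = trans (cong (λ z → suc (z + 4)) (sym (ℕ.m∸n+n≡m 4≤x))) (shift (x ∸ 4))

  1≤received : ∀ n v → 1ℚ ≤ received n v
  1≤received n v@(a , b) = ℚ.≤-trans 1≤∑contribution (∑contribution≤received n v)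
    where
    1≤∑contribution : 1ℚ ≤ ∑ n (λ a → ∑ n (contribution n (coords v) a))
    1≤∑contribution with T? (nearBorder n (toℕ a) ∨ nearBorder n (toℕ b))
    ... | yes border = 1≤∑contribution-border n (toℕ a) (toℕ b) (Fin.toℕ<n a) (Fin.toℕ<n b) border
    ... | no interior
      with interior-coordinate {n} (λ t → interior (Equivalence.from T-∨ (inj₁ t)))
         | interior-coordinate {n} (λ t → interior (Equivalence.from (T-∨ {nearBorder n (toℕ a)}) (inj₂ t)))
    ...   | x , x+4≡a , x+9≤n | y , y+4≡b , y+9≤n =
      subst (λ u → 1ℚ ≤ ∑ n (λ a → ∑ n (contribution n u a))) (cong₂ _,_ x+4≡a y+4≡b)
        (1≤∑contribution-interior n x y x+9≤n y+9≤n)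

  latticeDom-dominates : ∀ n → T (isPorousExpDom (King n) (latticeDom n))
  latticeDom-dominates n = all⁻ (λ v → 1ℚ ℚ.≤ᵇ received n v) {FinGraph.verts (King n)}
    (All.tabulate (λ {v} _ → ℚ.≤⇒≤ᵇ (1≤received n v)))

module LatticeCount where
  open import Data.Fin.Properties using (all?)
  open import Data.Nat using (_+_; _*_; _∸_; _/_; _%_; _≡ᵇ_; _<ᵇ_; _≤ᵇ_; _≤_; _<_; z≤n; s≤s; _≤?_; _≟_)
  open import Data.Nat.DivMod using (m%n<n; m≡m%n+[m/n]*n; m/n*n≤m)
  open import Relation.Nullary using (¬_; yes; no)
  open import Relation.Nullary.Decidable using (from-yes)
  open RangeSum ℕ.+-0-isCommutativeMonoid
  open Ordered ℕ.≤-isPreorder ℕ.+-mono-≤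
  open Residue
  open FinGraphProperties using (γ*ₑ-≤)
  open LatticeDomination using (multipleOf23; onLattice; nearBorder; inLatticeDom; latticeDom; latticeDom-dominates)

  indicator : Bool → ℕ
  indicator b = if b then 1 else 0

  indicator-∨ : ∀ p q → indicator (p ∨ q) ≤ indicator p + indicator q
  indicator-∨ true  q = s≤s z≤n
  indicator-∨ false q = ℕ.≤-refl

  indicator-false : ∀ {b} → ¬ T b → indicator b ≡ 0
  indicator-false {false} _  = refl
  indicator-false {true}  ¬b with () ← ¬b _

  length-filterᵇ : ∀ {A : Set} (p : A → Bool) xs → length (filterᵇ p xs) ≡ listSum (map (indicator ∘ p) xs)
  length-filterᵇ p []       = refl
  length-filterᵇ p (x ∷ xs) with p x
  ... | true  = cong suc (length-filterᵇ p xs)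
  ... | false = length-filterᵇ p xs

  ∑-const : ∀ n k → ∑ n (λ _ → k) ≡ n * k
  ∑-const zero    k = refl
  ∑-const (suc n) k = cong (k +_) (∑-const n k)

  ∑-*ˡ : ∀ n k (f : ℕ → ℕ) → ∑ n (λ i → k * f i) ≡ k * ∑ n f
  ∑-*ˡ zero    k f = sym (ℕ.*-zeroʳ k)
  ∑-*ˡ (suc n) k f = trans (cong (k * f 0 +_) (∑-*ˡ n k (f ∘ suc))) (sym (ℕ.*-distribˡ-+ k (f 0) _))

  ∑-indicator≤ : ∀ n (p : ℕ → Bool) → ∑ n (indicator ∘ p) ≤ n
  ∑-indicator≤ zero    p = z≤n
  ∑-indicator≤ (suc n) p = ℕ.+-mono-≤ (indicator≤1 (p 0)) (∑-indicator≤ n (p ∘ suc))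
    where
    indicator≤1 : ∀ b → indicator b ≤ 1
    indicator≤1 true  = ℕ.≤-refl
    indicator≤1 false = z≤n

  count-< : ∀ k n → ∑ n (λ x → indicator (x <ᵇ k)) ≤ k
  count-< k       zero    = z≤n
  count-< zero    (suc n) = ℕ.≤-reflexive (∑-zero n)
  count-< (suc k) (suc n) = s≤s (count-< k n)

  count-≥ : ∀ k n → ∑ n (λ x → indicator (n ≤ᵇ x + k)) ≤ k
  count-≥ k n with n ≤? k
  ... | yes n≤k = ℕ.≤-trans (∑-indicator≤ n _) n≤k
  ... | no  n≰k = subst (λ n → ∑ n (λ x → indicator (n ≤ᵇ x + k)) ≤ k) (ℕ.m∸n+n≡m (ℕ.<⇒≤ (ℕ.≰⇒> n≰k)))
                        (count-≥-shifted (n ∸ k))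
    where
    count-≥-shifted : ∀ m → ∑ (m + k) (λ x → indicator (m + k ≤ᵇ x + k)) ≤ k
    count-≥-shifted m = begin
      ∑ (m + k) f                          ≡⟨ ∑-split m k f ⟩
      ∑ m f + ∑ k (λ i → f (m + i))        ≡⟨ cong (_+ ∑ k (λ i → f (m + i))) (trans (∑-cong-< m below) (∑-zero m)) ⟩
      ∑ k (λ i → f (m + i))                ≤⟨ ∑-indicator≤ k _ ⟩
      k                                    ∎
      where
      open ℕ.≤-Reasoning
      f : ℕ → ℕ
      f x = indicator (m + k ≤ᵇ x + k)
      below : ∀ x → x < m → f x ≡ 0
      below x x<m = indicator-false (λ t → ℕ.<⇒≱ x<m (ℕ.+-cancelʳ-≤ k m x (ℕ.≤ᵇ⇒≤ (m + k) (x + k) t)))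

  count-nearBorder : ∀ n → ∑ n (indicator ∘ nearBorder n) ≤ 8
  count-nearBorder n = begin
    ∑ n (indicator ∘ nearBorder n)                                    ≤⟨ ∑-mono n (λ x → indicator-∨ (x <ᵇ 4) (n ≤ᵇ x + 4)) ⟩
    ∑ n (λ x → indicator (x <ᵇ 4) + indicator (n ≤ᵇ x + 4))             ≡⟨ ∑-distrib n _ _ ⟩
    ∑ n (λ x → indicator (x <ᵇ 4)) + ∑ n (λ x → indicator (n ≤ᵇ x + 4)) ≤⟨ ℕ.+-mono-≤ (count-< 4 n) (count-≥ 4 n) ⟩
    8                                                                   ∎
    where open ℕ.≤-Reasoning

  count-multiples-block : ∀ t → ∑ 23 (λ b → indicator (multipleOf23 (t + b))) ≡ 1
  count-multiples-block t = begin
    ∑ 23 (λ b → indicator (multipleOf23 (t + b)))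
      ≡⟨ ∑-cong 23 (λ b → cong (λ r → indicator (r ≡ᵇ 0)) ([m%d+n]%d≡[m+n]%d t b 23)) ⟨
    ∑ 23 (λ b → indicator (multipleOf23 (t % 23 + b)))
      ≡⟨ residue-elim {λ r → ∑ 23 (λ b → indicator (multipleOf23 (r + b))) ≡ 1} 23 block-Fin t ⟩
    1  ∎
    where
    open ≡-Reasoning
    block-Fin : ∀ (r : Fin 23) → ∑ 23 (λ b → indicator (multipleOf23 (toℕ r + b))) ≡ 1
    block-Fin = from-yes (all? {n = 23} (λ r → ∑ 23 (λ b → indicator (multipleOf23 (toℕ r + b))) ≟ 1))

  count-multiples-blocks : ∀ q t → ∑ (q * 23) (λ b → indicator (multipleOf23 (t + b))) ≡ q
  count-multiples-blocks zero    t = refl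
  count-multiples-blocks (suc q) t = begin
    ∑ (23 + q * 23) (λ b → indicator (multipleOf23 (t + b)))
      ≡⟨ ∑-split 23 (q * 23) (λ b → indicator (multipleOf23 (t + b))) ⟩
    ∑ 23 (λ b → indicator (multipleOf23 (t + b))) + ∑ (q * 23) (λ b → indicator (multipleOf23 (t + (23 + b))))
      ≡⟨ cong₂ _+_ (count-multiples-block t)
                   (∑-cong (q * 23) (λ b → cong (indicator ∘ multipleOf23) (sym (ℕ.+-assoc t 23 b)))) ⟩
    1 + ∑ (q * 23) (λ b → indicator (multipleOf23 (t + 23 + b)))
      ≡⟨ cong suc (count-multiples-blocks q (t + 23)) ⟩
    suc q  ∎
    where open ≡-Reasoning

  count-multiples : ∀ t n → ∑ n (λ b → indicator (multipleOf23 (t + b))) ≤ suc (n / 23)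
  count-multiples t n = begin
    ∑ n (λ b → indicator (multipleOf23 (t + b)))                   ≤⟨ ∑-window (λ _ → z≤n) 0 n n≤blocks ⟩
    ∑ (suc (n / 23) * 23) (λ b → indicator (multipleOf23 (t + b)))  ≡⟨ count-multiples-blocks (suc (n / 23)) t ⟩
    suc (n / 23)                                                   ∎
    where
    open ℕ.≤-Reasoning
    n≤blocks : n ≤ suc (n / 23) * 23
    n≤blocks = begin
      n                         ≡⟨ m≡m%n+[m/n]*n n 23 ⟩
      n % 23 + n / 23 * 23      ≤⟨ ℕ.+-monoˡ-≤ (n / 23 * 23) (ℕ.<⇒≤ (m%n<n n 23)) ⟩
      23 + n / 23 * 23          ∎

  count-row : ∀ n x → ∑ n (λ y → indicator (inLatticeDom n x y)) ≤ n * indicator (nearBorder n x) + (8 + suc (n / 23))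
  count-row n x = begin
    ∑ n (λ y → indicator (inLatticeDom n x y))
      ≤⟨ ∑-mono n (λ y → ℕ.≤-trans (indicator-∨ _ (onLattice x y))
                                   (ℕ.+-monoˡ-≤ _ (indicator-∨ (nearBorder n x) (nearBorder n y)))) ⟩
    ∑ n (λ y → (indicator (nearBorder n x) + indicator (nearBorder n y)) + indicator (onLattice x y))
      ≡⟨ trans (∑-distrib n _ _) (cong (_+ ∑ n (λ y → indicator (onLattice x y))) (∑-distrib n _ _)) ⟩
    (∑ n (λ _ → indicator (nearBorder n x)) + ∑ n (indicator ∘ nearBorder n)) + ∑ n (λ y → indicator (onLattice x y))
      ≤⟨ ℕ.+-mono-≤ (ℕ.+-mono-≤ (ℕ.≤-reflexive (∑-const n _)) (count-nearBorder n)) (count-multiples (4 * x) n) ⟩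
    (n * indicator (nearBorder n x) + 8) + suc (n / 23)
      ≡⟨ ℕ.+-assoc (n * indicator (nearBorder n x)) 8 _ ⟩
    n * indicator (nearBorder n x) + (8 + suc (n / 23))  ∎
    where open ℕ.≤-Reasoning

  length-latticeDom : ∀ n → 23 * length (latticeDom n) ≤ n * n + 391 * n
  length-latticeDom n = begin
    23 * length (latticeDom n)
      ≡⟨ cong (23 *_) (trans (length-filterᵇ _ verts) (listSum-grid n (λ x y → indicator (inLatticeDom n x y)))) ⟩
    23 * ∑ n (λ x → ∑ n (λ y → indicator (inLatticeDom n x y)))
      ≤⟨ ℕ.*-monoʳ-≤ 23 (∑-mono n (count-row n)) ⟩
    23 * ∑ n (λ x → n * indicator (nearBorder n x) + (8 + suc (n / 23)))
      ≡⟨ cong (23 *_) (trans (∑-distrib n _ _) (cong₂ _+_ (∑-*ˡ n n _) (∑-const n _))) ⟩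
    23 * (n * ∑ n (indicator ∘ nearBorder n) + n * (8 + suc (n / 23)))
      ≤⟨ ℕ.*-monoʳ-≤ 23 (ℕ.+-monoˡ-≤ _ (ℕ.*-monoʳ-≤ n (count-nearBorder n))) ⟩
    23 * (n * 8 + n * (8 + suc (n / 23)))
      ≡⟨ expand n (n / 23) ⟩
    n * (n / 23 * 23) + 391 * n
      ≤⟨ ℕ.+-monoˡ-≤ (391 * n) (ℕ.*-monoʳ-≤ n (m/n*n≤m n 23)) ⟩
    n * n + 391 * n  ∎
    where
    open ℕ.≤-Reasoning
    open FinGraph (King n) using (verts)
    expand : ∀ n q → 23 * (n * 8 + n * (8 + suc q)) ≡ n * (q * 23) + 391 * n
    expand = solve-∀

  23*γ*ₑ-King≤ : ∀ n → 23 * γ*ₑ (King n) ≤ n * n + 391 * n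
  23*γ*ₑ-King≤ n = ℕ.≤-trans
    (ℕ.*-monoʳ-≤ 23 (γ*ₑ-≤ (King n) (filterᵇ-∈-sublists _ (FinGraph.verts (King n))) (latticeDom-dominates n)))
    (length-latticeDom n)

module CrossMultiplication where
  open import Data.Integer as ℤ using (+_; +≤+)
  import Data.Integer.Properties as ℤ
  open import Data.Nat using (_+_; _*_; _≤_; NonZero)
  open import Data.Nat.Coprimality using (Coprime; 1-coprimeTo)
  import Data.Nat.Coprimality as Coprime
  open import Data.Rational using (mkℚ; toℚᵘ)
  open import Data.Rational.Unnormalised as ℚᵘ using (mkℚᵘ; *≤*)
  import Data.Rational.Unnormalised.Properties as ℚᵘ

  toℚᵘ-ℕ→ℚ : ∀ m → toℚᵘ (ℕ→ℚ m) ℚᵘ.≃ mkℚᵘ (+ m) 0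
  toℚᵘ-ℕ→ℚ m = ℚᵘ.≃-reflexive (cong toℚᵘ (ℚ.normalize-coprime (Coprime.sym (1-coprimeTo m))))

  ℕ→ℚ≤[1/23+p/q]*ℕ→ℚ : ∀ G m p q-1 .(c : Coprime p (suc q-1)) →
    G * (23 * suc q-1) ≤ (suc q-1 + p * 23) * m →
    ℕ→ℚ G ℚ.≤ (+ 1 ℚ./ 23 ℚ.+ mkℚ (+ p) q-1 c) ℚ.* ℕ→ℚ m
  ℕ→ℚ≤[1/23+p/q]*ℕ→ℚ G m p q-1 c G≤ = ℚ.toℚᵘ-cancel-≤
    (ℚᵘ.≤-respʳ-≃ (ℚᵘ.≃-sym rhs≃) (ℚᵘ.≤-respˡ-≃ (ℚᵘ.≃-sym (toℚᵘ-ℕ→ℚ G)) (*≤* (subst₂ ℤ._≤_ lhs≡ rhs≡ (+≤+ G≤′)))))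
    where
    G≤′ : G * (23 * suc q-1 * 1) ≤ (suc q-1 + p * 23) * m * 1
    G≤′ = subst₂ _≤_ (cong (G *_) (sym (ℕ.*-identityʳ (23 * suc q-1)))) (sym (ℕ.*-identityʳ _)) G≤
    rhs≃ : toℚᵘ ((+ 1 ℚ./ 23 ℚ.+ mkℚ (+ p) q-1 c) ℚ.* ℕ→ℚ m) ℚᵘ.≃ (mkℚᵘ (+ 1) 22 ℚᵘ.+ mkℚᵘ (+ p) q-1) ℚᵘ.* mkℚᵘ (+ m) 0
    rhs≃ = ℚᵘ.≃-trans (ℚ.toℚᵘ-homo-* (+ 1 ℚ./ 23 ℚ.+ mkℚ (+ p) q-1 c) (ℕ→ℚ m))
      (ℚᵘ.*-cong (ℚ.toℚᵘ-homo-+ (+ 1 ℚ./ 23) (mkℚ (+ p) q-1 c)) (toℚᵘ-ℕ→ℚ m))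
    lhs≡ : + (G * (23 * suc q-1 * 1)) ≡ + G ℤ.* + (23 * suc q-1 * 1)
    lhs≡ = ℤ.pos-* G (23 * suc q-1 * 1)
    rhs≡ : + ((suc q-1 + p * 23) * m * 1) ≡ ((+ 1 ℤ.* + suc q-1 ℤ.+ + p ℤ.* + 23) ℤ.* + m) ℤ.* + 1
    rhs≡ = begin
      + ((suc q-1 + p * 23) * m * 1)                   ≡⟨ ℤ.pos-* ((suc q-1 + p * 23) * m) 1 ⟩
      + ((suc q-1 + p * 23) * m) ℤ.* + 1               ≡⟨ cong (ℤ._* + 1) (ℤ.pos-* (suc q-1 + p * 23) m) ⟩
      (+ (suc q-1 + p * 23) ℤ.* + m) ℤ.* + 1           ≡⟨ cong (λ z → (z ℤ.* + m) ℤ.* + 1) (ℤ.pos-+ (suc q-1) (p * 23)) ⟩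
      ((+ suc q-1 ℤ.+ + (p * 23)) ℤ.* + m) ℤ.* + 1     ≡⟨ cong (λ z → ((z ℤ.+ + (p * 23)) ℤ.* + m) ℤ.* + 1) (ℤ.*-identityˡ (+ suc q-1)) ⟨
      ((+ 1 ℤ.* + suc q-1 ℤ.+ + (p * 23)) ℤ.* + m) ℤ.* + 1
                                                       ≡⟨ cong (λ z → ((+ 1 ℤ.* + suc q-1 ℤ.+ z) ℤ.* + m) ℤ.* + 1) (ℤ.pos-* p 23) ⟩
      ((+ 1 ℤ.* + suc q-1 ℤ.+ + p ℤ.* + 23) ℤ.* + m) ℤ.* + 1  ∎
      where open ≡-Reasoning

  absorb-linear-term : ∀ G n p {q-1} .{{_ : NonZero p}} → 23 * G ≤ n * n + 391 * n → 17 * suc q-1 ≤ n →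
    G * (23 * suc q-1) ≤ (suc q-1 + p * 23) * (n * n)
  absorb-linear-term G n p {q-1} 23G≤ 17q≤n = begin
    G * (23 * q)                                ≡⟨ regroup₁ G q ⟩
    (23 * G) * q                                ≤⟨ ℕ.*-monoˡ-≤ q 23G≤ ⟩
    (n * n + 391 * n) * q                       ≡⟨ regroup₂ n q ⟩
    q * (n * n) + 23 * (n * (17 * q))           ≤⟨ ℕ.+-monoʳ-≤ (q * (n * n)) (ℕ.*-monoʳ-≤ 23 (ℕ.*-monoʳ-≤ n 17q≤n)) ⟩
    q * (n * n) + 23 * (n * n)                  ≤⟨ ℕ.+-monoʳ-≤ (q * (n * n)) (ℕ.*-monoʳ-≤ 23 (ℕ.m≤n*m (n * n) p)) ⟩
    q * (n * n) + 23 * (p * (n * n))            ≡⟨ regroup₃ q p (n * n) ⟩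
    (q + p * 23) * (n * n)                      ∎
    where
    open ℕ.≤-Reasoning
    q : ℕ
    q = suc q-1
    regroup₁ : ∀ G q → G * (23 * q) ≡ (23 * G) * q
    regroup₁ = solve-∀
    regroup₂ : ∀ n q → (n * n + 391 * n) * q ≡ q * (n * n) + 23 * (n * (17 * q))
    regroup₂ = solve-∀
    regroup₃ : ∀ q p m → q * m + 23 * (p * m) ≡ (q + p * 23) * m
    regroup₃ = solve-∀

open LatticeCount using (23*γ*ₑ-King≤)
open CrossMultiplication using (ℕ→ℚ≤[1/23+p/q]*ℕ→ℚ; absorb-linear-term)

open import Data.Integer using (+_; +<+; +[1+_]; -[1+_])
open import Data.Nat using (_≥_; _*_)
open import Data.Product using (∃)
open import Data.Rational using (mkℚ; *<*; _<_; _≤_; _+_; _/_)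
import Data.Rational as Q

theorem3p2 : (ε : ℚ) → 0ℚ < ε →
    ∃ λ N → (n : ℕ) → n ≥ N →
    ℕ→ℚ (γ*ₑ (King n)) ≤ ((+ 1 / 23) + ε) Q.* ℕ→ℚ (n * n)
theorem3p2 (mkℚ (+ 0)      _   _) (*<* (+<+ ()))
theorem3p2 (mkℚ -[1+ _ ]   _   _) (*<* ())
theorem3p2 (mkℚ +[1+ p-1 ] q-1 c) _ = 17 * suc q-1 , λ n n≥N →
  ℕ→ℚ≤[1/23+p/q]*ℕ→ℚ (γ*ₑ (King n)) (n * n) (suc p-1) q-1 c
    (absorb-linear-term (γ*ₑ (King n)) n (suc p-1) (23*γ*ₑ-King≤ n) n≥N)
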